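{- If $A$ is an alternating sign matrix that classically avoids $321$, then the SW key of $A$ also avoids $321$.
   Context: An alternating sign matrix (ASM) of size $n$ is an $n\times n$ matrix with entries in $\{0,1,-1\}$ such that every row and every column sums to $1$ and the nonzero entries of each row and of each column alternate in sign. Position $(i,j)$ is the $i$-th row from the top and $j$-th column from the left. The permutation matrix of $\sigma=\sigma(1)\dots\sigma(n)$ has a $1$ in row $i$, column $\sigma(i)$ for each $i$. A matrix classically contains the permutation $\pi$ of size $k$ if, treating $-1$ entries as $0$, there are rows $r_1<\dots<r_k$ and columns $c_1<\dots<c_k$ such that the entry at $(r_a,c_{\pi(a)})$ is $1$ for all $a$; otherwise it classically avoids $\pi$. In particular it classically contains $321$ iff there are entries $1$ at $(x_1,y_3),(x_2,y_2),(x_3,y_1)$ with $x_1<x_2<x_3$ and $y_1<y_2<y_3$. For permutation matrices this coincides with usual permutation pattern containment. SW key process: a $-1$ entry is removable if no other $-1$ entry lies weakly southwest of it. For a removable $-1$ at $(i,j)$, let $(i,j_0)$ be the nearest $1$ to its west in its row and $(i_0,j)$ the nearest $1$ below it in its column; its neighboring $1$s are the $1$ entries weakly southwest of it such that no other $1$ entry lies both weakly northeast of them and weakly southwest of the $-1$. Consider the $1$s at $(i,j_0)$, $(i_0,j)$ and the neighboring $1$s lying in the rectangle of rows $i..i_0$ and columns $j_0..j$. Replace the south-most of these $1$s by $0$; then moving east to west, for each subsequent one of these $1$s, in column $c$ say, place a new $1$ in the row of the previously replaced $1$ and column $c$, and replace the old $1$ in column $c$ by $0$; finally replace the $-1$ by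 $0$. Repeating until no $-1$ remains yields a permutation matrix (the SW key of $A$), independent of the order of removals. -}

module Defs where

open import Data.Nat using (ℕ; zero; suc)
open import Data.Fin using (Fin; zero; suc; _<_; _≤_)
open import Data.Integer using (ℤ; 0ℤ; 1ℤ; -1ℤ; _+_; -_)
open import Data.Product using (Σ; ∃; ∃-syntax; _×_; _,_)
open import Data.Sum using (_⊎_)
open import Relation.Binary.PropositionalEquality using (_≡_; _≢_)
open import Relation.Nullary using (¬_)
open import Relation.Binary.Construct.Closure.ReflexiveTransitive using (Star)

-- An n×n integer matrix; entry (i , j) = row i (from the top), column j (from the left).
-- Row index increasing = going south; column index increasing = going east.
Matrix : ℕ → Set
Matrix n = Fin n → Fin n → ℤ

sumℤ : ∀ {n} → (Fin n → ℤ) → ℤ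
sumℤ {zero}  f = 0ℤ
sumℤ {suc n} f = f zero + sumℤ (λ i → f (suc i))

record IsASM {n : ℕ} (A : Matrix n) : Set where
  field
    entries : ∀ i j → A i j ≡ 0ℤ ⊎ A i j ≡ 1ℤ ⊎ A i j ≡ -1ℤ
    rowSum  : ∀ i → sumℤ (λ j → A i j) ≡ 1ℤ
    colSum  : ∀ j → sumℤ (λ i → A i j) ≡ 1ℤ
    rowAlt  : ∀ i j₁ j₂ → j₁ < j₂ → A i j₁ ≢ 0ℤ → A i j₂ ≢ 0ℤ →
              (∀ j → j₁ < j → j < j₂ → A i j ≡ 0ℤ) → A i j₂ ≡ - A i j₁
    colAlt  : ∀ j i₁ i₂ → i₁ < i₂ → A i₁ j ≢ 0ℤ → A i₂ j ≢ 0ℤ →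
              (∀ i → i₁ < i → i < i₂ → A i j ≡ 0ℤ) → A i₂ j ≡ - A i₁ j

-- classical containment of 321 (−1 entries treated as 0)
Contains321 : ∀ {n} → Matrix n → Set
Contains321 {n} A =
  ∃[ x₁ ] ∃[ x₂ ] ∃[ x₃ ] ∃[ y₁ ] ∃[ y₂ ] ∃[ y₃ ]
    (x₁ < x₂ × x₂ < x₃ × y₁ < y₂ × y₂ < y₃ ×
     A x₁ y₃ ≡ 1ℤ × A x₂ y₂ ≡ 1ℤ × A x₃ y₁ ≡ 1ℤ)

Avoids321 : ∀ {n} → Matrix n → Set
Avoids321 A = ¬ Contains321 A

WeaklySW : ∀ {n} → Fin n → Fin n → Fin n → Fin n → Set
WeaklySW p q i j = i ≤ p × q ≤ j

Removable : ∀ {n} → Matrix n → Fin n → Fin n → Set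
Removable A i j =
  A i j ≡ -1ℤ ×
  (∀ p q → WeaklySW p q i j → A p q ≡ -1ℤ → p ≡ i × q ≡ j)

NearestWest : ∀ {n} → Matrix n → Fin n → Fin n → Fin n → Set
NearestWest A i j j₀ =
  j₀ < j × A i j₀ ≡ 1ℤ × (∀ q → j₀ < q → q < j → A i q ≢ 1ℤ)

NearestSouth : ∀ {n} → Matrix n → Fin n → Fin n → Fin n → Set
NearestSouth A i j i₀ =
  i < i₀ × A i₀ j ≡ 1ℤ × (∀ p → i < p → p < i₀ → A p j ≢ 1ℤ)

Neighboring : ∀ {n} → Matrix n → Fin n → Fin n → Fin n → Fin n → Set
Neighboring A i j p q =
  A p q ≡ 1ℤ × WeaklySW p q i j ×
  (∀ p' q' → A p' q' ≡ 1ℤ → WeaklySW p q p' q' → WeaklySW p' q' i j →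
     p' ≡ p × q' ≡ q)

InS : ∀ {n} → Matrix n → (i j j₀ i₀ p q : Fin n) → Set
InS A i j j₀ i₀ p q =
  i ≤ p × p ≤ i₀ × j₀ ≤ q × q ≤ j × A p q ≡ 1ℤ ×
  ((p ≡ i × q ≡ j₀) ⊎ (p ≡ i₀ × q ≡ j) ⊎ Neighboring A i j p q)

-- a new 1 is placed at (p , q): (p' , q) ∈ S, and (p , q') ∈ S is the
-- element of S immediately east of it (the previously replaced 1 when
-- processing S from east to west)
NewOne : ∀ {n} → Matrix n → (i j j₀ i₀ p q : Fin n) → Set
NewOne A i j j₀ i₀ p q =
  ∃[ p' ] ∃[ q' ]
    (InS A i j j₀ i₀ p' q × InS A i j j₀ i₀ p q' × q < q' ×
     (∀ p'' q'' → InS A i j j₀ i₀ p'' q'' → ¬ (q < q'' × q'' < q')))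

RemoveAt : ∀ {n} → Matrix n → Fin n → Fin n → Matrix n → Set
RemoveAt A i j B =
  Removable A i j ×
  Σ _ λ j₀ → Σ _ λ i₀ →
    NearestWest A i j j₀ × NearestSouth A i j i₀ ×
    (∀ p q →
      ((p ≡ i × q ≡ j) → B p q ≡ 0ℤ) ×
      (¬ (p ≡ i × q ≡ j) → InS A i j j₀ i₀ p q → B p q ≡ 0ℤ) ×
      (¬ (p ≡ i × q ≡ j) → ¬ InS A i j j₀ i₀ p q →
         NewOne A i j j₀ i₀ p q → B p q ≡ 1ℤ) ×
      (¬ (p ≡ i × q ≡ j) → ¬ InS A i j j₀ i₀ p q →
         ¬ NewOne A i j j₀ i₀ p q → B p q ≡ A p q))

SWStep : ∀ {n} → Matrix n → Matrix n → Set
SWStep A B = ∃[ i ] ∃[ j ] RemoveAt A i j B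

IsSWKey : ∀ {n} → Matrix n → Matrix n → Set
IsSWKey A K = Star SWStep A K × (∀ p q → K p q ≢ -1ℤ)

{-# OPTIONS --safe #-}
-- One removal step already preserves 321-avoidance, for any integer matrix.  The 1s of S are neighboring
-- 1s, i.e. maximal 1s weakly SW of the −1, so they form a NW–SE staircase; the step
-- deletes them and puts new 1s at the inner corners of the staircase.  Since every 1
-- weakly SW of the −1 lies weakly SW of a neighboring 1, no such 1 lies strictly NE of
-- an inner corner.  Hence two new 1s never form a 21, and a 321 through one new 1 can be
-- rerouted through the staircase (or through the 1 west of the −1) to a 321 of A.
module Submission where

open import Defs
open import Data.Nat using (ℕ)
import Data.Nat.Properties as ℕ
open import Data.Fin using (Fin; _<_; _≤_; _>_)
open import Data.Fin.Properties
  using (_≟_; _≤?_; _<?_; any?; ≤-refl; ≤-trans; ≤-antisym; <-trans; <⇒≢; ≤∧≢⇒<)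
open import Data.Fin.Induction using (<-wellFounded; >-wellFounded)
open import Data.Integer using (ℤ; 0ℤ; 1ℤ; -1ℤ) renaming (_≟_ to _≟ℤ_)
open import Data.Product using (∃-syntax; _×_; _,_; proj₁; proj₂)
open import Data.Product.Relation.Binary.Lex.Strict using (×-Lex; ×-wellFounded)
open import Data.Sum using (_⊎_; inj₁; inj₂)
open import Data.Empty using (⊥; ⊥-elim)
open import Induction.WellFounded using (WellFounded; Acc; acc)
open import Function using (_∘_)
open import Relation.Binary.PropositionalEquality using (_≡_; refl; sym; trans)
open import Relation.Binary.Construct.Closure.ReflexiveTransitive using (Star; ε; _◅_)
open import Relation.Nullary using (¬_; Dec; yes; no; ¬?; _×-dec_; contradiction)
open import Relation.Nullary.Decidable using (decidable-stable; ¬¬-excluded-middle)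
open import Relation.Nullary.Negation using (¬¬-map)

weaklySW? : ∀ {n} (p q i j : Fin n) → Dec (WeaklySW p q i j)
weaklySW? p q i j = i ≤? p ×-dec q ≤? j

WeaklySW-refl : ∀ {n} {p q : Fin n} → WeaklySW p q p q
WeaklySW-refl = ≤-refl , ≤-refl

WeaklySW-trans : ∀ {n} {p q r s u v : Fin n} →
                 WeaklySW p q r s → WeaklySW r s u v → WeaklySW p q u v
WeaklySW-trans (r≤p , q≤s) (u≤r , s≤v) = ≤-trans u≤r r≤p , ≤-trans q≤s s≤v

contains321 : ∀ {n} {A : Matrix n} {x₁ x₂ x₃ y₁ y₂ y₃ : Fin n} →
              x₁ < x₂ → x₂ < x₃ → y₁ < y₂ → y₂ < y₃ →
              A x₁ y₃ ≡ 1ℤ → A x₂ y₂ ≡ 1ℤ → A x₃ y₁ ≡ 1ℤ → Contains321 A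
contains321 x₁<x₂ x₂<x₃ y₁<y₂ y₂<y₃ a₁ a₂ a₃ =
  _ , _ , _ , _ , _ , _ , x₁<x₂ , x₂<x₃ , y₁<y₂ , y₂<y₃ , a₁ , a₂ , a₃

module Neighbors {n : ℕ} (A : Matrix n) (i j : Fin n) where

  CoveredBy : (u v p q : Fin n) → Set
  CoveredBy u v p q =
    (A p q ≡ 1ℤ × WeaklySW u v p q × WeaklySW p q i j) × ¬ (p ≡ u × q ≡ v)

  coveredBy? : ∀ u v p q → Dec (CoveredBy u v p q)
  coveredBy? u v p q =
    ((A p q ≟ℤ 1ℤ) ×-dec weaklySW? u v p q ×-dec weaklySW? p q i j) ×-dec ¬? (p ≟ u ×-dec q ≟ v)

  _≺_ : (Fin n × Fin n) → (Fin n × Fin n) → Set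
  _≺_ = ×-Lex _≡_ _<_ _>_

  ≺-wellFounded : WellFounded _≺_
  ≺-wellFounded = ×-wellFounded <-wellFounded >-wellFounded

  coveredBy⇒≺ : ∀ {u v p q} → CoveredBy u v p q → (p , q) ≺ (u , v)
  coveredBy⇒≺ {u} {p = p} ((_ , (p≤u , v≤q) , _) , pq≢uv) with p ≟ u
  ... | yes refl = inj₂ (refl , ≤∧≢⇒< v≤q λ { refl → pq≢uv (refl , refl) })
  ... | no p≢u = inj₁ (≤∧≢⇒< p≤u p≢u)

  neighboring-weaklyNE-of-one : ∀ {u v} → A u v ≡ 1ℤ → WeaklySW u v i j →
                                ∃[ p ] ∃[ q ] (Neighboring A i j p q × WeaklySW u v p q)
  neighboring-weaklyNE-of-one = go (≺-wellFounded _)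
    where
    go : ∀ {u v} → Acc _≺_ (u , v) → A u v ≡ 1ℤ → WeaklySW u v i j →
         ∃[ p ] ∃[ q ] (Neighboring A i j p q × WeaklySW u v p q)
    go {u} {v} (acc rec) Auv uv≤ij with any? (λ p → any? (coveredBy? u v p))
    ... | yes (p , q , covered@((Apq , uv≤pq , pq≤ij) , _)) =
      let (r , c , neighboring , pq≤rc) = go (rec (coveredBy⇒≺ covered)) Apq pq≤ij
      in r , c , neighboring , WeaklySW-trans uv≤pq pq≤rc
    ... | no uncovered = u , v , (Auv , uv≤ij , maximal) , WeaklySW-refl
      where
      maximal : ∀ p q → A p q ≡ 1ℤ → WeaklySW u v p q → WeaklySW p q i j → p ≡ u × q ≡ v
      maximal p q Apq uv≤pq pq≤ij = decidable-stable (p ≟ u ×-dec q ≟ v)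
        λ pq≢uv → uncovered (p , q , (Apq , uv≤pq , pq≤ij) , pq≢uv)

  neighboring-increasing : ∀ {p p′ q q′} → Neighboring A i j p′ q → Neighboring A i j p q′ →
                           q < q′ → p′ < p
  neighboring-increasing {p} {p′} {q′ = q′} (_ , _ , maximal) (Apq′ , pq′≤ij , _) q<q′ with p′ <? p
  ... | yes p′<p = p′<p
  ... | no p′≮p = contradiction (sym (proj₂ (maximal p q′ Apq′ (ℕ.≮⇒≥ p′≮p , ℕ.<⇒≤ q<q′) pq′≤ij)))
                                (<⇒≢ q<q′)

module _ {n : ℕ} {A : Matrix n} {i j : Fin n} (Aij : A i j ≡ -1ℤ) where

  nearestWest⇒neighboring : ∀ {j₀} → NearestWest A i j j₀ → Neighboring A i j i j₀
  nearestWest⇒neighboring {j₀} (j₀<j , Aij₀ , nearest) = Aij₀ , (≤-refl , ℕ.<⇒≤ j₀<j) , maximal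
    where
    maximal : ∀ p q → A p q ≡ 1ℤ → WeaklySW i j₀ p q → WeaklySW p q i j → p ≡ i × q ≡ j₀
    maximal p q Apq (p≤i , j₀≤q) (i≤p , q≤j) with ≤-antisym p≤i i≤p | q ≟ j | j₀ ≟ q
    ... | refl | yes refl | _        = contradiction (trans (sym Aij) Apq) λ ()
    ... | refl | no _     | yes refl = refl , refl
    ... | refl | no q≢j   | no j₀≢q  = contradiction Apq (nearest q (≤∧≢⇒< j₀≤q j₀≢q) (≤∧≢⇒< q≤j q≢j))

  nearestSouth⇒neighboring : ∀ {i₀} → NearestSouth A i j i₀ → Neighboring A i j i₀ j
  nearestSouth⇒neighboring {i₀} (i<i₀ , Ai₀j , nearest) = Ai₀j , (ℕ.<⇒≤ i<i₀ , ≤-refl) , maximal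
    where
    maximal : ∀ p q → A p q ≡ 1ℤ → WeaklySW i₀ j p q → WeaklySW p q i j → p ≡ i₀ × q ≡ j
    maximal p q Apq (p≤i₀ , j≤q) (i≤p , q≤j) with ≤-antisym q≤j j≤q | i ≟ p | p ≟ i₀
    ... | refl | yes refl | _        = contradiction (trans (sym Aij) Apq) λ ()
    ... | refl | no _     | yes refl = refl , refl
    ... | refl | no i≢p   | no p≢i₀  = contradiction Apq (nearest p (≤∧≢⇒< i≤p i≢p) (≤∧≢⇒< p≤i₀ p≢i₀))

module Removal {n : ℕ} {A : Matrix n} {i j j₀ i₀ : Fin n} (Aij : A i j ≡ -1ℤ)
               (nw : NearestWest A i j j₀) (ns : NearestSouth A i j i₀) where

  open Neighbors A i j

  S New : Fin n → Fin n → Set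
  S   = InS A i j j₀ i₀
  New = NewOne A i j j₀ i₀

  S⇒neighboring : ∀ {p q} → S p q → Neighboring A i j p q
  S⇒neighboring (_ , _ , _ , _ , _ , inj₁ (refl , refl))        = nearestWest⇒neighboring Aij nw
  S⇒neighboring (_ , _ , _ , _ , _ , inj₂ (inj₁ (refl , refl))) = nearestSouth⇒neighboring Aij ns
  S⇒neighboring (_ , _ , _ , _ , _ , inj₂ (inj₂ neighboring))   = neighboring

  neighboring⇒S : ∀ {p q} → Neighboring A i j p q → p ≤ i₀ → j₀ ≤ q → S p q
  neighboring⇒S nb@(Apq , (i≤p , q≤j) , _) p≤i₀ j₀≤q = i≤p , p≤i₀ , j₀≤q , q≤j , Apq , inj₂ (inj₂ nb)

  S-increasing : ∀ {p p′ q q′} → S p′ q → S p q′ → q < q′ → p′ < p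
  S-increasing s s′ = neighboring-increasing (S⇒neighboring s) (S⇒neighboring s′)

  New-not-SW-of-S : ∀ {p q r c} → New p q → S r c → r < p → q < c → ⊥
  New-not-SW-of-S {r = r} {c} (_ , q′ , _ , s′ , q<q′ , gap) src r<p q<c with c <? q′
  ... | yes c<q′ = gap r c src (q<c , c<q′)
  ... | no c≮q′ =
    let (_ , _ , maximal) = S⇒neighboring s′
        (Arc , rc≤ij , _) = S⇒neighboring src
    in <⇒≢ r<p (proj₁ (maximal r c Arc (ℕ.<⇒≤ r<p , ℕ.≮⇒≥ c≮q′) rc≤ij))

  New-not-SW-of-one : ∀ {p q u v} → New p q → A u v ≡ 1ℤ → WeaklySW u v i j → u < p → q < v → ⊥
  New-not-SW-of-one new@(_ , _ , (_ , _ , j₀≤q , _) , (_ , p≤i₀ , _) , _) Auv uv≤ij u<p q<v =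
    let (r , c , neighboring , (r≤u , v≤c)) = neighboring-weaklyNE-of-one Auv uv≤ij
        r<p = ℕ.≤-<-trans r≤u u<p
        q<c = ℕ.<-≤-trans q<v v≤c
        src = neighboring⇒S neighboring (ℕ.<⇒≤ (ℕ.<-≤-trans r<p p≤i₀)) (ℕ.<⇒≤ (ℕ.≤-<-trans j₀≤q q<c))
    in New-not-SW-of-S new src r<p q<c

  New-antichain : ∀ {p q P Q} → New p q → New P Q → P < p → q < Q → ⊥
  New-antichain new (_ , _ , s , s′ , Q<Q′ , _) P<p q<Q =
    New-not-SW-of-S new s (<-trans (S-increasing s s′ Q<Q′) P<p) q<Q

  new-top : ∀ {x₁ x₂ x₃ y₁ y₂ y₃} → x₁ < x₂ → x₂ < x₃ → y₁ < y₂ → y₂ < y₃ →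
            New x₁ y₃ → A x₂ y₂ ≡ 1ℤ → A x₃ y₁ ≡ 1ℤ → Contains321 A
  new-top x₁<x₂ x₂<x₃ y₁<y₂ y₂<y₃ (_ , _ , s@(_ , _ , _ , _ , Ap′y₃ , _) , s′ , y₃<q′ , _) a₂ a₃ =
    contains321 (<-trans (S-increasing s s′ y₃<q′) x₁<x₂) x₂<x₃ y₁<y₂ y₂<y₃ Ap′y₃ a₂ a₃

  new-middle : ∀ {x₁ x₂ x₃ y₁ y₂ y₃} → x₁ < x₂ → x₂ < x₃ → y₁ < y₂ → y₂ < y₃ →
               A x₁ y₃ ≡ 1ℤ → New x₂ y₂ → A x₃ y₁ ≡ 1ℤ → Contains321 A
  new-middle {x₁} {y₃ = y₃} x₁<x₂ x₂<x₃ y₁<y₂ y₂<y₃ a₁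
             new@(p′ , q′ , s@(i≤p′ , _ , _ , _ , Ap′y₂ , _) , s′@(_ , _ , _ , q′≤j , Ax₂q′ , _) , y₂<q′ , _)
             a₃
    with x₁ <? p′ | q′ <? y₃
  ... | yes x₁<p′ | _ =
    contains321 x₁<p′ (<-trans (S-increasing s s′ y₂<q′) x₂<x₃) y₁<y₂ y₂<y₃ a₁ Ap′y₂ a₃
  ... | no _ | yes q′<y₃ =
    contains321 x₁<x₂ x₂<x₃ (<-trans y₁<y₂ y₂<q′) q′<y₃ a₁ Ax₂q′ a₃
  ... | no x₁≮p′ | no q′≮y₃ =
    ⊥-elim (New-not-SW-of-one new a₁ (≤-trans i≤p′ (ℕ.≮⇒≥ x₁≮p′) , ≤-trans (ℕ.≮⇒≥ q′≮y₃) q′≤j)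
                              x₁<x₂ y₂<y₃)

  new-bottom : ∀ {x₁ x₂ x₃ y₁ y₂ y₃} → x₁ < x₂ → x₂ < x₃ → y₁ < y₂ → y₂ < y₃ →
               A x₁ y₃ ≡ 1ℤ → A x₂ y₂ ≡ 1ℤ → New x₃ y₁ → Contains321 A
  new-bottom {x₂ = x₂} {y₂ = y₂} x₁<x₂ x₂<x₃ y₁<y₂ y₂<y₃ a₁ a₂
             new@(_ , q′ , (_ , _ , j₀≤y₁ , _) , (_ , _ , _ , q′≤j , Ax₃q′ , _) , _)
    with q′ <? y₂ | x₂ <? i
  ... | yes q′<y₂ | _ =
    contains321 x₁<x₂ x₂<x₃ q′<y₂ y₂<y₃ a₁ a₂ Ax₃q′
  ... | no _ | yes x₂<i =
    contains321 x₁<x₂ x₂<i (ℕ.≤-<-trans j₀≤y₁ y₁<y₂) y₂<y₃ a₁ a₂ (proj₁ (proj₂ nw))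
  ... | no q′≮y₂ | no x₂≮i =
    ⊥-elim (New-not-SW-of-one new a₂ (ℕ.≮⇒≥ x₂≮i , ≤-trans (ℕ.≮⇒≥ q′≮y₂) q′≤j) x₂<x₃ y₁<y₂)

  avoids : (B : Matrix n) → (∀ {p q} → B p q ≡ 1ℤ → ¬ New p q → A p q ≡ 1ℤ) →
           Avoids321 A → Avoids321 B
  avoids B old-one A-avoids (x₁ , x₂ , x₃ , y₁ , y₂ , y₃ , x₁<x₂ , x₂<x₃ , y₁<y₂ , y₂<y₃ , b₁ , b₂ , b₃) =
    old-or-new b₁ λ o₁ → old-or-new b₂ λ o₂ → old-or-new b₃ λ o₃ → cases o₁ o₂ o₃
    where
    old-or-new : ∀ {p q} → B p q ≡ 1ℤ → ¬ ¬ (A p q ≡ 1ℤ ⊎ New p q)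
    old-or-new Bpq≡1 = ¬¬-map (λ { (yes new) → inj₂ new ; (no ¬new) → inj₁ (old-one Bpq≡1 ¬new) })
                              ¬¬-excluded-middle

    cases : A x₁ y₃ ≡ 1ℤ ⊎ New x₁ y₃ → A x₂ y₂ ≡ 1ℤ ⊎ New x₂ y₂ → A x₃ y₁ ≡ 1ℤ ⊎ New x₃ y₁ → ⊥
    cases (inj₁ a₁) (inj₁ a₂) (inj₁ a₃) = A-avoids (contains321 x₁<x₂ x₂<x₃ y₁<y₂ y₂<y₃ a₁ a₂ a₃)
    cases (inj₂ n₁) (inj₁ a₂) (inj₁ a₃) = A-avoids (new-top x₁<x₂ x₂<x₃ y₁<y₂ y₂<y₃ n₁ a₂ a₃)
    cases (inj₁ a₁) (inj₂ n₂) (inj₁ a₃) = A-avoids (new-middle x₁<x₂ x₂<x₃ y₁<y₂ y₂<y₃ a₁ n₂ a₃)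
    cases (inj₁ a₁) (inj₁ a₂) (inj₂ n₃) = A-avoids (new-bottom x₁<x₂ x₂<x₃ y₁<y₂ y₂<y₃ a₁ a₂ n₃)
    cases (inj₂ n₁) (inj₂ n₂) _         = New-antichain n₂ n₁ x₁<x₂ y₂<y₃
    cases _         (inj₂ n₂) (inj₂ n₃) = New-antichain n₃ n₂ x₂<x₃ y₁<y₂
    cases (inj₂ n₁) _         (inj₂ n₃) =
      New-antichain n₃ n₁ (<-trans x₁<x₂ x₂<x₃) (<-trans y₁<y₂ y₂<y₃)

unchanged-one : ∀ {P Q R : Set} {a b : ℤ} →
                (P → b ≡ 0ℤ) × (¬ P → Q → b ≡ 0ℤ) ×
                (¬ P → ¬ Q → R → b ≡ 1ℤ) × (¬ P → ¬ Q → ¬ R → b ≡ a) →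
                b ≡ 1ℤ → ¬ R → a ≡ 1ℤ
unchanged-one {P} {Q} {b = b} (zero-if-P , zero-if-Q , _ , unchanged) b≡1 ¬R =
  trans (sym (unchanged ¬P ¬Q ¬R)) b≡1
  where
  b≢0 : ¬ b ≡ 0ℤ
  b≢0 b≡0 = contradiction (trans (sym b≡0) b≡1) λ ()
  ¬P : ¬ P
  ¬P = b≢0 ∘ zero-if-P
  ¬Q : ¬ Q
  ¬Q = b≢0 ∘ zero-if-Q ¬P

SWStep-preserves-Avoids321 : ∀ {n} {A B : Matrix n} → SWStep A B → Avoids321 A → Avoids321 B
SWStep-preserves-Avoids321 {B = B} (_ , _ , (Aij , _) , _ , _ , nw , ns , rule) =
  Removal.avoids Aij nw ns B (λ {p} {q} → unchanged-one (rule p q))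

SWKeyPath-preserves-Avoids321 : ∀ {n} {A K : Matrix n} → Star SWStep A K → Avoids321 A → Avoids321 K
SWKeyPath-preserves-Avoids321 ε             avoids = avoids
SWKeyPath-preserves-Avoids321 (step ◅ path) avoids =
  SWKeyPath-preserves-Avoids321 path (SWStep-preserves-Avoids321 step avoids)

lemma4p3 : (n : ℕ) (A : Matrix n) → IsASM A → Avoids321 A →
           (K : Matrix n) → IsSWKey A K → Avoids321 K
lemma4p3 _ _ _ A-avoids _ (path , _) = SWKeyPath-preserves-Avoids321 path A-avoids
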